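{- Let $C$ be a set and $F,G$ Plott functions on $C$. Let $((Y_i,Z_i))_{i\in I}$ be a family of semi-stable pairs, and put $Y=\bigcup_{i\in I}Y_i$, $Z=\bigcap_{i\in I}Z_i$. Then $(Y,Z)$ is a semi-stable pair.
   Context: A choice function on a set $C$ is a map $G:2^C\to 2^C$ with $G(X)\subseteq X$ for all $X\subseteq C$; it is a Plott function if $G(X\cup Y)=G(G(X)\cup Y)$ for all $X,Y\subseteq C$. Given Plott functions $F,G$ on $C$, a pair $(Y,Z)$ of subsets of $C$ is semi-stable if $Y\cup Z=C$ and $G(Y)\subseteq F(Z)$. -}

module Defs where

open import Level using (Level; suc)
open import Relation.Unary using (Pred; _⊆_; _∪_; _≐_; Universal; ⋃; ⋂)
open import Data.Product using (_×_)

module _ {a ℓ : Level} (C : Set a) where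

  -- A choice function: a map on subsets with G X ⊆ X.  Since subsets are
  -- predicates, we require G to be well defined on sets, i.e. to respect
  -- extensional equality of subsets.
  record ChoiceFunction : Set (a Level.⊔ suc ℓ) where
    field
      apply   : Pred C ℓ → Pred C ℓ
      respect : ∀ {X X′} → X ≐ X′ → apply X ≐ apply X′
      sub     : ∀ X → apply X ⊆ X

  open ChoiceFunction public

  IsPlott : ChoiceFunction → Set (a Level.⊔ suc ℓ)
  IsPlott G = ∀ (X Y : Pred C ℓ) → apply G (X ∪ Y) ≐ apply G (apply G X ∪ Y)

  SemiStable : ChoiceFunction → ChoiceFunction → Pred C ℓ → Pred C ℓ → Set (a Level.⊔ ℓ)
  SemiStable F G Y Z = Universal (Y ∪ Z) × (apply G Y ⊆ apply F Z)

{-# OPTIONS --safe #-}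
-- Plott functions satisfy Chernoff's heritage property: if X ⊆ W then every
-- element of X chosen from W is already chosen from X (classically, split W
-- into X and W ∖ X and apply path independence).  Hence an element x chosen
-- by G from Y = ⋃ Yᵢ is chosen from the Yᵢ containing it, and so lies in
-- F(Zᵢ).  The same argument shows x ∈ Zⱼ for every j (either x ∈ Yⱼ and
-- x ∈ F(Zⱼ) ⊆ Zⱼ, or x ∉ Yⱼ and x ∈ Zⱼ by the cover property), so x ∈ Z
-- and heritage for F moves x from F(Zᵢ) down to F(Z).
module Submission where

open import Defs
open import Level using (Level; _⊔_; Lift; lift; lower)
open import Relation.Unary using (Pred; ⋃; ⋂; _⊆_; _∩_; _∪_; _∖_; _≐_; Universal)
open import Axiom.ExcludedMiddle using (ExcludedMiddle)
open import Data.Product using (_,_; proj₁; proj₂)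
open import Data.Sum using (inj₁; inj₂)
open import Data.Empty using (⊥-elim)
open import Function using (_∘_)
open import Relation.Nullary using (Dec; yes; no)
open import Relation.Nullary.Decidable using (map′)

module _ {a ℓ : Level} (em : ExcludedMiddle (a ⊔ ℓ)) where

  decide : (P : Set ℓ) → Dec P
  decide P = map′ lower lift (em {Lift a P})

  ⊆⇒≐∪∖ : {C : Set a} {X W : Pred C ℓ} → X ⊆ W → W ≐ X ∪ (W ∖ X)
  ⊆⇒≐∪∖ {X = X} X⊆W = split , λ { (inj₁ y∈X) → X⊆W y∈X ; (inj₂ y∈W∖X) → proj₁ y∈W∖X }
    where
      split : _ ⊆ X ∪ (_ ∖ X)
      split {y} y∈W with decide (X y)
      ... | yes y∈X = inj₁ y∈X
      ... | no  y∉X = inj₂ (y∈W , y∉X)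

  module _ {C : Set a} (G : ChoiceFunction {a} {ℓ} C) (plott : IsPlott C G) where

    plott⇒heritage : {X W : Pred C ℓ} → X ⊆ W → apply G W ∩ X ⊆ apply G X
    plott⇒heritage {X} {W} X⊆W (x∈GW , x∈X)
      with sub G _ (proj₁ (plott X (W ∖ X)) (proj₁ (respect G (⊆⇒≐∪∖ X⊆W)) x∈GW))
    ... | inj₁ x∈GX      = x∈GX
    ... | inj₂ (_ , x∉X) = ⊥-elim (x∉X x∈X)

    chosen-from-⋃ : {I : Set ℓ} {Ys : I → Pred C ℓ} (i : I) → apply G (⋃ I Ys) ∩ Ys i ⊆ apply G (Ys i)
    chosen-from-⋃ i = plott⇒heritage (i ,_)

  module _ {C : Set a} (F G : ChoiceFunction {a} {ℓ} C) (plottG : IsPlott C G)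
           {I : Set ℓ} {Ys Zs : I → Pred C ℓ} (semiStable : ∀ i → SemiStable C F G (Ys i) (Zs i)) where

    ⋃-∪-⋂-universal : Universal (⋃ I Ys ∪ ⋂ I Zs)
    ⋃-∪-⋂-universal x with decide (⋃ I Ys x)
    ... | yes x∈Y = inj₁ x∈Y
    ... | no  x∉Y = inj₂ x∈Z
      where
        x∈Z : ⋂ I Zs x
        x∈Z i with proj₁ (semiStable i) x
        ... | inj₁ x∈Yᵢ = ⊥-elim (x∉Y (i , x∈Yᵢ))
        ... | inj₂ x∈Zᵢ = x∈Zᵢ

    chosen-from-⋃⊆F : ∀ i → apply G (⋃ I Ys) ∩ Ys i ⊆ apply F (Zs i)
    chosen-from-⋃⊆F i = proj₂ (semiStable i) ∘ chosen-from-⋃ G plottG i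

    chosen-from-⋃⊆⋂ : apply G (⋃ I Ys) ⊆ ⋂ I Zs
    chosen-from-⋃⊆⋂ {x} x∈GY j with decide (Ys j x) | proj₁ (semiStable j) x
    ... | yes x∈Yⱼ | _         = sub F _ (chosen-from-⋃⊆F j (x∈GY , x∈Yⱼ))
    ... | no  x∉Yⱼ | inj₁ x∈Yⱼ = ⊥-elim (x∉Yⱼ x∈Yⱼ)
    ... | no  _    | inj₂ x∈Zⱼ = x∈Zⱼ

lemma6 : {a ℓ : Level} → ExcludedMiddle (a Level.⊔ ℓ)
           → (C : Set a) (F G : ChoiceFunction {a} {ℓ} C)
           → IsPlott C F → IsPlott C G
           → (I : Set ℓ) (Ys Zs : I → Pred C ℓ)
           → (∀ i → SemiStable C F G (Ys i) (Zs i))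
           → SemiStable C F G (⋃ I Ys) (⋂ I Zs)
lemma6 em C F G plottF plottG I Ys Zs semiStable = ⋃-∪-⋂-universal em F G plottG semiStable , GY⊆FZ
  where
    GY⊆FZ : apply G (⋃ I Ys) ⊆ apply F (⋂ I Zs)
    GY⊆FZ x∈GY with sub G _ x∈GY
    ... | i , x∈Yᵢ =
      plott⇒heritage em F plottF (λ x∈Z → x∈Z i)
        (chosen-from-⋃⊆F em F G plottG semiStable i (x∈GY , x∈Yᵢ) , chosen-from-⋃⊆⋂ em F G plottG semiStable x∈GY)
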